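{- Let $\mathcal G$ be an MCS, let $f=f_{\mu_L,\mu_H}$ be a (possibly tagged) bi-multiset level mapping for $\mathcal G$, and define $\Phi_f(p(\bar x))=p_f^{high}(\bar x)-p_f^{low}(\bar x)$ (multiset difference, of type $\mu_D$). Let $g=p(\bar x)\,:\!-\,\pi;\,q(\bar y)$ be a transition rule. If $f$ orients $g$, then $\pi\models\Phi_f(p(\bar x))\succsim^{\mu_D}\Phi_f(q(\bar y))$; and if $f$ orients $g$ strictly, then $\pi\models\Phi_f(p(\bar x))\succ^{\mu_D}\Phi_f(q(\bar y))$.
   Context: MCS: a finite set of transition rules over program points with fixed arities; a transition rule is $p(\bar x)\,:\!-\,\pi;\,q(\bar y)$ with $\bar x,\bar y$ tuples of distinct variables (of the arities of $p,q$) and $\pi$ a conjunction of constraints $a>b$, $a\ge b$ with $a,b\in\bar x\cup\bar y$, variables ranging over $\mathbb Z$. For an expression relation $R$, $\pi\models R$ means $R$ holds for every integer assignment satisfying $\pi$. Multiset types and orders on finite multisets of integers: (max) $S\succsim^{max}T$ iff $\max S\ge\max T$ or $T=\emptyset$; $S\succ^{max}T$ iff $\max S>\max T$ or ($T=\emptyset\ne S$). (min) $S\succsim^{min}T$ iff $\min S\ge\min T$ or $S=\emptyset$; $S\succ^{min}T$ iff $\min S>\min T$ or ($S=\emptyset\ne T$). (ms) $S\succ^{ms}T$ iff $T$ arises from $S$ by replacing a non-empty sub-multiset $U$ by a multiset $V$ with $U\succ^{max}V$; $S\succsim^{ms}T$ iff $S\succ^{ms}T$ or $S=T$. (dms) $S\succ^{dms}T$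 iff $T$ arises from $S$ by replacing a sub-multiset $U$ by a non-empty $V$ with $U\succ^{min}V$; $S\succsim^{dms}T$ iff $S\succ^{dms}T$ or $S=T$. We write $A\precsim^\mu B$ for $B\succsim^\mu A$, similarly $\prec^\mu$. Multiset difference of non-empty $L,H$ of types $\mu_L,\mu_H$: if $\mu_L\in\{max,min\}$, $H-L=\{h-\mu_L(L):h\in H\}$ of type $\mu_H$; if $\mu_L\in\{ms,dms\}$ and $\mu_H\in\{min,max\}$, $H-L=\{\mu_H(H)-\ell:\ell\in L\}$ of type $dms$ if $\mu_L=ms$ and $ms$ if $\mu_L=dms$; otherwise undefined ($\mu_L,\mu_H$ compatible iff defined). Level mapping: a bi-multiset level mapping $f_{\mu_L,\mu_H}$ (with $\mu_L,\mu_H$ compatible) assigns to each program point $p$ two sub-multisets of its argument positions (a low and a high selection), depending only on $p$; $p_f^{low}(\bar x)$ and $p_f^{high}(\bar x)$ are the multisets of the values at the selected positions, of types $\mu_L$, $\mu_H$. In a tagged level mapping each selected position $i$ of $p$ carries a natural tag $t<M$ ($M$ the sum of the arities of all program points) and contributes the integer $Mx_i+t$ instead of $x_i$. $f$ orients $g=p(\bar x)\,:\!-\,\pi;\,q(\bar y)$ if $\pi\models p_f^{high}(\bar x)\succsim^{\mu_H}q_f^{high}(\bar y)$ and $\pi\models p_f^{low}(\bar x)\precsim^{\mu_L}q_f^{low}(\bar y)$; it orients $g$ strictly if in addition $\pi\models p_f^{high}(\bar x)\succ^{\mu_H}q_f^{high}(\bar y)$ or $\pi\models p_f^{low}(\bar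 x)\prec^{\mu_L}q_f^{low}(\bar y)$. -}

module Defs where

open import Data.Nat as ℕ using (ℕ; zero; suc)
open import Data.Nat.ListAction using (sum)
open import Data.Integer as ℤ using (ℤ; _+_; _-_; _*_; _≤_; _<_; _⊔_; _⊓_; +_)
open import Data.Fin using (Fin; zero; suc; toℕ)
open import Data.Fin.Subset using (Subset; Nonempty)
open import Data.Bool using (Bool; true; false)
open import Data.Vec using (Vec; lookup; []; _∷_)
open import Data.List using (List; []; _∷_; _++_; map; allFin)
open import Data.List.Relation.Binary.Permutation.Propositional using (_↭_)
open import Data.Maybe using (Maybe; just; nothing)
open import Data.Product using (Σ; _×_; _,_; ∃)
open import Data.Sum using (_⊎_)
open import Relation.Binary.PropositionalEquality using (_≡_; _≢_)

-- Finite multisets of integers are represented by lists, up to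
-- permutation (_↭_).

maxOf : List ℤ → Maybe ℤ
maxOf []       = nothing
maxOf (x ∷ xs) with maxOf xs
... | nothing = just x
... | just m  = just (x ⊔ m)

minOf : List ℤ → Maybe ℤ
minOf []       = nothing
minOf (x ∷ xs) with minOf xs
... | nothing = just x
... | just m  = just (x ⊓ m)

data MSType : Set where
  max min ms dms : MSType

_≿max_ : List ℤ → List ℤ → Set
S ≿max T = (∃ λ s → ∃ λ t → maxOf S ≡ just s × maxOf T ≡ just t × t ≤ s) ⊎ T ≡ []

_≻max_ : List ℤ → List ℤ → Set
S ≻max T = (∃ λ s → ∃ λ t → maxOf S ≡ just s × maxOf T ≡ just t × t < s) ⊎ (T ≡ [] × S ≢ [])

_≿min_ : List ℤ → List ℤ → Set
S ≿min T = (∃ λ s → ∃ λ t → minOf S ≡ just s × minOf T ≡ just t × t ≤ s) ⊎ S ≡ []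

_≻min_ : List ℤ → List ℤ → Set
S ≻min T = (∃ λ s → ∃ λ t → minOf S ≡ just s × minOf T ≡ just t × t < s) ⊎ (S ≡ [] × T ≢ [])

-- (ms): T arises from S by replacing a non-empty sub-multiset U by V
-- with U ≻max V.  "U is a sub-multiset of S, the rest being W" is
-- S ↭ W ++ U; the result is W ++ V.
_≻ms_ : List ℤ → List ℤ → Set
S ≻ms T = ∃ λ W → ∃ λ U → ∃ λ V →
  S ↭ W ++ U × T ↭ W ++ V × U ≢ [] × U ≻max V

_≿ms_ : List ℤ → List ℤ → Set
S ≿ms T = S ≻ms T ⊎ S ↭ T

_≻dms_ : List ℤ → List ℤ → Set
S ≻dms T = ∃ λ W → ∃ λ U → ∃ λ V →
  S ↭ W ++ U × T ↭ W ++ V × V ≢ [] × U ≻min V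

_≿dms_ : List ℤ → List ℤ → Set
S ≿dms T = S ≻dms T ⊎ S ↭ T

_≿[_]_ : List ℤ → MSType → List ℤ → Set
S ≿[ max ] T = S ≿max T
S ≿[ min ] T = S ≿min T
S ≿[ ms  ] T = S ≿ms T
S ≿[ dms ] T = S ≿dms T

_≻[_]_ : List ℤ → MSType → List ℤ → Set
S ≻[ max ] T = S ≻max T
S ≻[ min ] T = S ≻min T
S ≻[ ms  ] T = S ≻ms T
S ≻[ dms ] T = S ≻dms T

-- compatibility of (μL , μH): exactly the cases where H - L is defined
data Compatible : MSType → MSType → Set where
  low-max : ∀ μH → Compatible max μH
  low-min : ∀ μH → Compatible min μH
  ms-max  : Compatible ms  max
  ms-min  : Compatible ms  min
  dms-max : Compatible dms max
  dms-min : Compatible dms min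

diffType : ∀ {μL μH} → Compatible μL μH → MSType
diffType (low-max μH) = μH
diffType (low-min μH) = μH
diffType ms-max  = dms
diffType ms-min  = dms
diffType dms-max = ms
diffType dms-min = ms

diff : ∀ {μL μH} → Compatible μL μH → (L H : List ℤ) → Maybe (List ℤ)
diff c [] H  = nothing
diff c L  [] = nothing
diff (low-max μH) L@(_ ∷ _) H@(_ ∷ _) with maxOf L
... | just m  = just (map (λ h → h - m) H)
... | nothing = nothing
diff (low-min μH) L@(_ ∷ _) H@(_ ∷ _) with minOf L
... | just m  = just (map (λ h → h - m) H)
... | nothing = nothing
diff ms-max  L@(_ ∷ _) H@(_ ∷ _) with maxOf H
... | just m  = just (map (λ l → m - l) L)
... | nothing = nothing
diff ms-min  L@(_ ∷ _) H@(_ ∷ _) with minOf H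
... | just m  = just (map (λ l → m - l) L)
... | nothing = nothing
diff dms-max L@(_ ∷ _) H@(_ ∷ _) with maxOf H
... | just m  = just (map (λ l → m - l) L)
... | nothing = nothing
diff dms-min L@(_ ∷ _) H@(_ ∷ _) with minOf H
... | just m  = just (map (λ l → m - l) L)
... | nothing = nothing

data Cmp : Set where
  gt ge : Cmp

Var : Set
Var = ℕ

Assignment : Set
Assignment = Var → ℤ

record DistinctVars (n : ℕ) : Set where
  field
    vars     : Vec Var n
    distinct : ∀ i j → lookup vars i ≡ lookup vars j → i ≡ j
open DistinctVars public

-- A constraint a ▷ b between variables of x̄ ∪ ȳ; a variable of x̄ ∪ ȳ
-- is designated by a position in x̄ (inj₁) or in ȳ (inj₂).
record Constraint (m n : ℕ) : Set where
  field
    cmp : Cmp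
    lhs : Fin m ⊎ Fin n
    rhs : Fin m ⊎ Fin n
open Constraint public

record ProgramPoints : Set where
  field
    #points : ℕ
    arity   : Fin #points → ℕ
open ProgramPoints public

totalArity : ProgramPoints → ℕ
totalArity P = sum (map (arity P) (allFin (#points P)))

record Rule (P : ProgramPoints) : Set where
  field
    src : Fin (#points P)
    tgt : Fin (#points P)
    x̄   : DistinctVars (arity P src)
    ȳ   : DistinctVars (arity P tgt)
    π   : List (Constraint (arity P src) (arity P tgt))
open Rule public

record MCS : Set where
  field
    points : ProgramPoints
    rules  : List (Rule points)
open MCS public

module _ {P : ProgramPoints} (g : Rule P) (σ : Assignment) where
  varOf : Fin (arity P (src g)) ⊎ Fin (arity P (tgt g)) → Var
  varOf (Data.Sum.inj₁ i) = lookup (vars (x̄ g)) i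
  varOf (Data.Sum.inj₂ j) = lookup (vars (ȳ g)) j

  holds : Constraint (arity P (src g)) (arity P (tgt g)) → Set
  holds c with cmp c
  ... | gt = σ (varOf (rhs c)) < σ (varOf (lhs c))
  ... | ge = σ (varOf (rhs c)) ≤ σ (varOf (lhs c))

  Sat : Set
  Sat = All′ (π g)
    where
    All′ : List (Constraint (arity P (src g)) (arity P (tgt g))) → Set
    All′ []       = Data.Unit.⊤
      where import Data.Unit
    All′ (c ∷ cs) = holds c × All′ cs

  xval : Fin (arity P (src g)) → ℤ
  xval i = σ (lookup (vars (x̄ g)) i)

  yval : Fin (arity P (tgt g)) → ℤ
  yval j = σ (lookup (vars (ȳ g)) j)

selected : ∀ {n} → Subset n → (Fin n → ℤ) → List ℤ
selected []          v = []
selected (true  ∷ s) v = v zero ∷ selected s (λ i → v (suc i))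
selected (false ∷ s) v = selected s (λ i → v (suc i))

record BiLevelMapping (P : ProgramPoints) (μL μH : MSType) : Set where
  field
    compat : Compatible μL μH
    low    : (p : Fin (#points P)) → Subset (arity P p)
    high   : (p : Fin (#points P)) → Subset (arity P p)
    -- nothing: untagged; just t: position i of p carries tag t p i < M
    tags   : Maybe ((p : Fin (#points P)) → Fin (arity P p) → Fin (totalArity P))
open BiLevelMapping public

module _ {P : ProgramPoints} {μL μH : MSType} (f : BiLevelMapping P μL μH) where
  contrib : (p : Fin (#points P)) → Fin (arity P p) → ℤ → ℤ
  contrib p i x with tags f
  ... | nothing = x
  ... | just t  = + totalArity P * x + + toℕ (t p i)

  lowVals : (p : Fin (#points P)) → (Fin (arity P p) → ℤ) → List ℤ
  lowVals p v = selected (low f p) (λ i → contrib p i (v i))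

  highVals : (p : Fin (#points P)) → (Fin (arity P p) → ℤ) → List ℤ
  highVals p v = selected (high f p) (λ i → contrib p i (v i))

  μD : MSType
  μD = diffType (compat f)

  Φ : (p : Fin (#points P)) → (Fin (arity P p) → ℤ) → Maybe (List ℤ)
  Φ p v = diff (compat f) (lowVals p v) (highVals p v)

  Orients : Rule P → Set
  Orients g =
    (∀ σ → Sat g σ → highVals (src g) (xval g σ) ≿[ μH ] highVals (tgt g) (yval g σ)) ×
    (∀ σ → Sat g σ → lowVals (tgt g) (yval g σ) ≿[ μL ] lowVals (src g) (xval g σ))

  OrientsStrictly : Rule P → Set
  OrientsStrictly g = Orients g ×
    ((∀ σ → Sat g σ → highVals (src g) (xval g σ) ≻[ μH ] highVals (tgt g) (yval g σ)) ⊎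
     (∀ σ → Sat g σ → lowVals (tgt g) (yval g σ) ≻[ μL ] lowVals (src g) (xval g σ)))

{-# OPTIONS --safe #-}
-- Φ_f takes an extremum m of one selection (the pivot: the low one if μL ∈ {max, min},
-- otherwise the high one) and maps the other selection by x ↦ x - m resp. x ↦ m - x.
-- Orienting the pivot selection gives m_p ≤ m_q resp. m_q ≤ m_p, so the map used
-- for q lies below the map used for p.  If the two pivots coincide, Φ_f(p) and
-- Φ_f(q) are images of an oriented pair under one strictly monotone (antitone) map,
-- which preserves (reverses, exchanging ms and dms) every order.  If they differ,
-- the q-map lies strictly below the p-map, and comparing extremal elements (for
-- ms and dms: replacing the whole multiset) already gives a strict decrease.
module Submission where

open import Data.Integer using (ℤ; _-_; _≤_; _<_; _≥_; _>_; _⊔_; _⊓_; _≟_)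
import Data.Integer.Properties as ℤ
open import Data.List using (List; []; _∷_; _++_; map)
open import Data.List.Properties using (map-++)
open import Data.List.Membership.Propositional using (_∈_)
open import Data.List.Membership.Propositional.Properties using (∈-map⁺; ∈-map⁻; ∈-++⁺ˡ; ∈-++⁺ʳ; ∈-++⁻)
open import Data.List.Relation.Unary.Any using (here; there)
open import Data.List.Relation.Binary.Permutation.Propositional using (_↭_; ↭-refl; ↭-sym; ↭-trans; ↭-reflexive)
open import Data.List.Relation.Binary.Permutation.Propositional.Properties using (∈-resp-↭; map⁺)
open import Data.Maybe using (Maybe; just; nothing)
open import Data.Maybe.Relation.Binary.Pointwise using (Pointwise; just)
open import Data.Product using (_×_; _,_; ∃; proj₁; proj₂)
open import Data.Sum as Sum using (_⊎_; inj₁; inj₂)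
open import Data.Empty using (⊥-elim)
open import Data.Bool using (true; false)
open import Data.Fin using (Fin; suc)
open import Data.Fin.Subset using (Subset; Nonempty)
open import Data.Vec using (_∷_; there)
open import Relation.Nullary using (yes; no)
open import Relation.Binary.Core using (_Preserves_⟶_)
open import Relation.Binary.PropositionalEquality using (_≡_; _≢_; refl; sym; trans; subst)

open import Defs

private
  variable
    x y a b : ℤ
    A B L H Lp Hp Lq Hq W : List ℤ
    μ μL μH : MSType
    R R′ : ℤ → ℤ → Set
    f g : ℤ → ℤ

≤⇒<⊎≡ : a ≤ b → a < b ⊎ a ≡ b
≤⇒<⊎≡ {a} {b} a≤b with a ≟ b
... | yes a≡b = inj₂ a≡b
... | no  a≢b = inj₁ (ℤ.≤∧≢⇒< a≤b a≢b)

sub-mono-≤ : x ≤ y → a ≤ b → x - b ≤ y - a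
sub-mono-≤ x≤y a≤b = ℤ.+-mono-≤ x≤y (ℤ.neg-mono-≤ a≤b)

sub-mono-<-≤ : x < y → a ≤ b → x - b < y - a
sub-mono-<-≤ x<y a≤b = ℤ.+-mono-<-≤ x<y (ℤ.neg-mono-≤ a≤b)

sub-mono-≤-< : x ≤ y → a < b → x - b < y - a
sub-mono-≤-< x≤y a<b = ℤ.+-mono-≤-< x≤y (ℤ.neg-mono-< a<b)

maxOf-∷ : ∀ x xs → ∃ λ s → maxOf (x ∷ xs) ≡ just s
maxOf-∷ x xs with maxOf xs
... | nothing = x , refl
... | just m  = x ⊔ m , refl

minOf-∷ : ∀ x xs → ∃ λ s → minOf (x ∷ xs) ≡ just s
minOf-∷ x xs with minOf xs
... | nothing = x , refl
... | just m  = x ⊓ m , refl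

maxOf-just : ∀ S {s} → maxOf S ≡ just s → s ∈ S × (∀ {x} → x ∈ S → x ≤ s)
maxOf-just (x ∷ xs) eq with maxOf xs in max≡
maxOf-just (x ∷ [])     refl | nothing = here refl , λ { (here refl) → ℤ.≤-refl }
maxOf-just (x ∷ y ∷ ys) refl | nothing with () ← trans (sym max≡) (proj₂ (maxOf-∷ y ys))
maxOf-just (x ∷ xs)     refl | just m = ⊔-∈ , ⊔-upper
  where
  m-max = maxOf-just xs max≡
  ⊔-∈ : x ⊔ m ∈ x ∷ xs
  ⊔-∈ with ℤ.⊔-sel x m
  ... | inj₁ x⊔m≡x = here x⊔m≡x
  ... | inj₂ x⊔m≡m = there (subst (_∈ xs) (sym x⊔m≡m) (proj₁ m-max))
  ⊔-upper : ∀ {z} → z ∈ x ∷ xs → z ≤ x ⊔ m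
  ⊔-upper (here refl)  = ℤ.i≤i⊔j x m
  ⊔-upper (there z∈xs) = ℤ.≤-trans (proj₂ m-max z∈xs) (ℤ.i≤j⊔i x m)

minOf-just : ∀ S {s} → minOf S ≡ just s → s ∈ S × (∀ {x} → x ∈ S → s ≤ x)
minOf-just (x ∷ xs) eq with minOf xs in min≡
minOf-just (x ∷ [])     refl | nothing = here refl , λ { (here refl) → ℤ.≤-refl }
minOf-just (x ∷ y ∷ ys) refl | nothing with () ← trans (sym min≡) (proj₂ (minOf-∷ y ys))
minOf-just (x ∷ xs)     refl | just m = ⊓-∈ , ⊓-lower
  where
  m-min = minOf-just xs min≡
  ⊓-∈ : x ⊓ m ∈ x ∷ xs
  ⊓-∈ with ℤ.⊓-sel x m
  ... | inj₁ x⊓m≡x = here x⊓m≡x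
  ... | inj₂ x⊓m≡m = there (subst (_∈ xs) (sym x⊓m≡m) (proj₁ m-min))
  ⊓-lower : ∀ {z} → z ∈ x ∷ xs → x ⊓ m ≤ z
  ⊓-lower (here refl)  = ℤ.i⊓j≤i x m
  ⊓-lower (there z∈xs) = ℤ.≤-trans (ℤ.i⊓j≤j x m) (proj₂ m-min z∈xs)

-- Bounds _≤_ A B and Bounds _≥_ B A say max A ≥ max B and min A ≥ min B (for
-- non-empty B resp. A); likewise for the strict relations.

Bounds : (ℤ → ℤ → Set) → List ℤ → List ℤ → Set
Bounds R A B = ∃ λ a → a ∈ A × (∀ {x} → x ∈ B → R x a)

Bounds-map : ∀ f g → (∀ {x a} → R x a → R′ (g x) (f a)) →
             Bounds R A B → Bounds R′ (map f A) (map g B)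
Bounds-map {R′ = R′} f g R⇒R′ (a , a∈A , B-R-a) =
  f a , ∈-map⁺ f a∈A , λ gx∈gB →
    let (x , x∈B , gx≡) = ∈-map⁻ g gx∈gB in subst (λ z → R′ z (f a)) (sym gx≡) (R⇒R′ (B-R-a x∈B))

∈⇒≢[] : x ∈ A → A ≢ []
∈⇒≢[] (here _)  ()
∈⇒≢[] (there _) ()

≿max⇒Bounds : B ≢ [] → A ≿max B → Bounds _≤_ A B
≿max⇒Bounds {B = B} {A = A} _ (inj₁ (s , t , max≡s , max≡t , t≤s)) =
  s , proj₁ (maxOf-just A max≡s) , λ x∈B → ℤ.≤-trans (proj₂ (maxOf-just B max≡t) x∈B) t≤s
≿max⇒Bounds B≢[] (inj₂ B≡[]) = ⊥-elim (B≢[] B≡[])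

Bounds⇒≿max : Bounds _≤_ A B → A ≿max B
Bounds⇒≿max {B = []} _ = inj₂ refl
Bounds⇒≿max {A = []} {B = _ ∷ _} (_ , () , _)
Bounds⇒≿max {A = x ∷ A} {B = y ∷ B} (a , a∈A , B≤a) =
  let (s , max≡s) = maxOf-∷ x A ; (t , max≡t) = maxOf-∷ y B in
  inj₁ (s , t , max≡s , max≡t ,
        ℤ.≤-trans (B≤a (proj₁ (maxOf-just _ max≡t))) (proj₂ (maxOf-just _ max≡s) a∈A))

≻max⇒Bounds : A ≻max B → Bounds _<_ A B
≻max⇒Bounds {A = A} {B = B} (inj₁ (s , t , max≡s , max≡t , t<s)) =
  s , proj₁ (maxOf-just A max≡s) , λ x∈B → ℤ.≤-<-trans (proj₂ (maxOf-just B max≡t) x∈B) t<s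
≻max⇒Bounds {A = []}    (inj₂ (refl , A≢[])) = ⊥-elim (A≢[] refl)
≻max⇒Bounds {A = x ∷ A} (inj₂ (refl , _))    = x , here refl , λ ()

Bounds⇒≻max : Bounds _<_ A B → A ≻max B
Bounds⇒≻max {B = []} (a , a∈A , _) = inj₂ (refl , ∈⇒≢[] a∈A)
Bounds⇒≻max {A = []} {B = _ ∷ _} (_ , () , _)
Bounds⇒≻max {A = x ∷ A} {B = y ∷ B} (a , a∈A , B<a) =
  let (s , max≡s) = maxOf-∷ x A ; (t , max≡t) = maxOf-∷ y B in
  inj₁ (s , t , max≡s , max≡t ,
        ℤ.<-≤-trans (B<a (proj₁ (maxOf-just _ max≡t))) (proj₂ (maxOf-just _ max≡s) a∈A))

≿min⇒Bounds : A ≢ [] → A ≿min B → Bounds _≥_ B A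
≿min⇒Bounds {A = A} {B = B} _ (inj₁ (s , t , min≡s , min≡t , t≤s)) =
  t , proj₁ (minOf-just B min≡t) , λ x∈A → ℤ.≤-trans t≤s (proj₂ (minOf-just A min≡s) x∈A)
≿min⇒Bounds A≢[] (inj₂ A≡[]) = ⊥-elim (A≢[] A≡[])

Bounds⇒≿min : Bounds _≥_ B A → A ≿min B
Bounds⇒≿min {A = []} _ = inj₂ refl
Bounds⇒≿min {B = []} {A = _ ∷ _} (_ , () , _)
Bounds⇒≿min {B = y ∷ B} {A = x ∷ A} (b , b∈B , b≤A) =
  let (s , min≡s) = minOf-∷ x A ; (t , min≡t) = minOf-∷ y B in
  inj₁ (s , t , min≡s , min≡t ,
        ℤ.≤-trans (proj₂ (minOf-just _ min≡t) b∈B) (b≤A (proj₁ (minOf-just _ min≡s))))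

≻min⇒Bounds : A ≻min B → Bounds _>_ B A
≻min⇒Bounds {A = A} {B = B} (inj₁ (s , t , min≡s , min≡t , t<s)) =
  t , proj₁ (minOf-just B min≡t) , λ x∈A → ℤ.<-≤-trans t<s (proj₂ (minOf-just A min≡s) x∈A)
≻min⇒Bounds {B = []}    (inj₂ (refl , B≢[])) = ⊥-elim (B≢[] refl)
≻min⇒Bounds {B = y ∷ B} (inj₂ (refl , _))    = y , here refl , λ ()

Bounds⇒≻min : Bounds _>_ B A → A ≻min B
Bounds⇒≻min {A = []} (b , b∈B , _) = inj₂ (refl , ∈⇒≢[] b∈B)
Bounds⇒≻min {B = []} {A = _ ∷ _} (_ , () , _)
Bounds⇒≻min {B = y ∷ B} {A = x ∷ A} (b , b∈B , b<A) =
  let (s , min≡s) = minOf-∷ x A ; (t , min≡t) = minOf-∷ y B in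
  inj₁ (s , t , min≡s , min≡t ,
        ℤ.≤-<-trans (proj₂ (minOf-just _ min≡t) b∈B) (b<A (proj₁ (minOf-just _ min≡s))))

≿ms-dominated : A ≿ms B → x ∈ B → ∃ λ y → y ∈ A × x ≤ y
≿ms-dominated (inj₂ A↭B) x∈B = _ , ∈-resp-↭ (↭-sym A↭B) x∈B , ℤ.≤-refl
≿ms-dominated (inj₁ (W , U , V , A↭W++U , B↭W++V , _ , U≻V)) x∈B
  with ∈-++⁻ W (∈-resp-↭ B↭W++V x∈B)
... | inj₁ x∈W = _ , ∈-resp-↭ (↭-sym A↭W++U) (∈-++⁺ˡ x∈W) , ℤ.≤-refl
... | inj₂ x∈V =
  let (u , u∈U , V<u) = ≻max⇒Bounds U≻V in
  u , ∈-resp-↭ (↭-sym A↭W++U) (∈-++⁺ʳ W u∈U) , ℤ.<⇒≤ (V<u x∈V)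

≿dms-dominated : A ≿dms B → x ∈ A → ∃ λ y → y ∈ B × y ≤ x
≿dms-dominated (inj₂ A↭B) x∈A = _ , ∈-resp-↭ A↭B x∈A , ℤ.≤-refl
≿dms-dominated (inj₁ (W , U , V , A↭W++U , B↭W++V , _ , U≻V)) x∈A
  with ∈-++⁻ W (∈-resp-↭ A↭W++U x∈A)
... | inj₁ x∈W = _ , ∈-resp-↭ (↭-sym B↭W++V) (∈-++⁺ˡ x∈W) , ℤ.≤-refl
... | inj₂ x∈U =
  let (v , v∈V , v<U) = ≻min⇒Bounds U≻V in
  v , ∈-resp-↭ (↭-sym B↭W++V) (∈-++⁺ʳ W v∈V) , ℤ.<⇒≤ (v<U x∈U)

≿ms⇒Bounds : A ≢ [] → A ≿ms B → Bounds _≤_ A B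
≿ms⇒Bounds {A = []}    A≢[] _ = ⊥-elim (A≢[] refl)
≿ms⇒Bounds {A = a ∷ A} _ A≿B =
  let (s , max≡s) = maxOf-∷ a A ; (s∈A , A≤s) = maxOf-just _ max≡s in
  s , s∈A , λ x∈B → let (y , y∈A , x≤y) = ≿ms-dominated A≿B x∈B in ℤ.≤-trans x≤y (A≤s y∈A)

≿dms⇒Bounds : B ≢ [] → A ≿dms B → Bounds _≥_ B A
≿dms⇒Bounds {B = []}    B≢[] _ = ⊥-elim (B≢[] refl)
≿dms⇒Bounds {B = b ∷ B} _ A≿B =
  let (s , min≡s) = minOf-∷ b B ; (s∈B , s≤B) = minOf-just _ min≡s in
  s , s∈B , λ x∈A → let (y , y∈B , y≤x) = ≿dms-dominated A≿B x∈A in ℤ.≤-trans (s≤B y∈B) y≤x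

Bounds⇒≻ms : A ≢ [] → Bounds _<_ A B → A ≻ms B
Bounds⇒≻ms {A = A} {B = B} A≢[] B<A = [] , A , B , ↭-refl , ↭-refl , A≢[] , Bounds⇒≻max B<A

Bounds⇒≻dms : B ≢ [] → Bounds _>_ B A → A ≻dms B
Bounds⇒≻dms {B = B} {A = A} B≢[] B<A = [] , A , B , ↭-refl , ↭-refl , B≢[] , Bounds⇒≻min B<A

≻⇒≿ : ∀ μ → A ≻[ μ ] B → A ≿[ μ ] B
≻⇒≿ max (inj₁ (s , t , max≡s , max≡t , t<s)) = inj₁ (s , t , max≡s , max≡t , ℤ.<⇒≤ t<s)
≻⇒≿ max (inj₂ (B≡[] , _))                     = inj₂ B≡[]
≻⇒≿ min (inj₁ (s , t , min≡s , min≡t , t<s)) = inj₁ (s , t , min≡s , min≡t , ℤ.<⇒≤ t<s)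
≻⇒≿ min (inj₂ (A≡[] , _))                     = inj₂ A≡[]
≻⇒≿ ms  A≻B = inj₁ A≻B
≻⇒≿ dms A≻B = inj₁ A≻B

map-≢[] : A ≢ [] → map f A ≢ []
map-≢[] {A = []} A≢[] = ⊥-elim (A≢[] refl)
map-≢[] {A = _ ∷ _} _ ()

map-↭-++ : ∀ (f : ℤ → ℤ) W → A ↭ W ++ B → map f A ↭ map f W ++ map f B
map-↭-++ {B = B} f W A↭W++B = ↭-trans (map⁺ f A↭W++B) (↭-reflexive (map-++ f W B))

<-mono⇒≤-mono : f Preserves _<_ ⟶ _<_ → f Preserves _≤_ ⟶ _≤_
<-mono⇒≤-mono f-mono x≤y with ≤⇒<⊎≡ x≤y
... | inj₁ x<y  = ℤ.<⇒≤ (f-mono x<y)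
... | inj₂ refl = ℤ.≤-refl

≻-map-mono : ∀ μ → f Preserves _<_ ⟶ _<_ → A ≻[ μ ] B → map f A ≻[ μ ] map f B
≻-map-mono {f = f} max f-mono A≻B = Bounds⇒≻max (Bounds-map f f f-mono (≻max⇒Bounds A≻B))
≻-map-mono {f = f} min f-mono A≻B = Bounds⇒≻min (Bounds-map f f f-mono (≻min⇒Bounds A≻B))
≻-map-mono {f = f} ms f-mono (W , U , V , A↭ , B↭ , U≢[] , U≻V) =
  map f W , map f U , map f V , map-↭-++ f W A↭ , map-↭-++ f W B↭ , map-≢[] U≢[] ,
  ≻-map-mono {A = U} {B = V} max f-mono U≻V
≻-map-mono {f = f} dms f-mono (W , U , V , A↭ , B↭ , V≢[] , U≻V) =
  map f W , map f U , map f V , map-↭-++ f W A↭ , map-↭-++ f W B↭ , map-≢[] V≢[] ,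
  ≻-map-mono {A = U} {B = V} min f-mono U≻V

≿-map-mono : ∀ μ → f Preserves _<_ ⟶ _<_ → A ≢ [] → B ≢ [] → A ≿[ μ ] B → map f A ≿[ μ ] map f B
≿-map-mono {f = f} {A = A} {B = B} max f-mono _ B≢[] A≿B =
  Bounds⇒≿max (Bounds-map f f (<-mono⇒≤-mono f-mono) (≿max⇒Bounds {A = A} B≢[] A≿B))
≿-map-mono {f = f} {A = A} {B = B} min f-mono A≢[] _ A≿B =
  Bounds⇒≿min (Bounds-map f f (<-mono⇒≤-mono f-mono) (≿min⇒Bounds {B = B} A≢[] A≿B))
≿-map-mono {f = f} ms  f-mono _ _ = Sum.map (≻-map-mono ms f-mono) (map⁺ f)
≿-map-mono {f = f} dms f-mono _ _ = Sum.map (≻-map-mono dms f-mono) (map⁺ f)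

≿⇒≻-lowered : ∀ μ → A ≢ [] → B ≢ [] → A ≿[ μ ] B → (∀ {x y} → x ≤ y → g x < f y) →
              map f A ≻[ μ ] map g B
≿⇒≻-lowered {g = g} {f = f} max _ B≢[] A≿B lower =
  Bounds⇒≻max (Bounds-map f g lower (≿max⇒Bounds B≢[] A≿B))
≿⇒≻-lowered {g = g} {f = f} min A≢[] _ A≿B lower =
  Bounds⇒≻min (Bounds-map g f lower (≿min⇒Bounds A≢[] A≿B))
≿⇒≻-lowered {g = g} {f = f} ms A≢[] _ A≿B lower =
  Bounds⇒≻ms (map-≢[] A≢[]) (Bounds-map f g lower (≿ms⇒Bounds A≢[] A≿B))
≿⇒≻-lowered {g = g} {f = f} dms _ B≢[] A≿B lower =
  Bounds⇒≻dms (map-≢[] B≢[]) (Bounds-map g f lower (≿dms⇒Bounds B≢[] A≿B))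

data MultisetOrder : MSType → Set where
  ms  : MultisetOrder ms
  dms : MultisetOrder dms

dual : MultisetOrder μ → MSType
dual ms  = dms
dual dms = ms

≻-map-anti : (k : MultisetOrder μ) → f Preserves _<_ ⟶ _>_ →
             A ≻[ μ ] B → map f B ≻[ dual k ] map f A
≻-map-anti {f = f} ms f-anti (W , U , V , A↭ , B↭ , U≢[] , U≻V) =
  map f W , map f V , map f U , map-↭-++ f W B↭ , map-↭-++ f W A↭ , map-≢[] U≢[] ,
  Bounds⇒≻min (Bounds-map f f f-anti (≻max⇒Bounds U≻V))
≻-map-anti {f = f} dms f-anti (W , U , V , A↭ , B↭ , V≢[] , U≻V) =
  map f W , map f V , map f U , map-↭-++ f W B↭ , map-↭-++ f W A↭ , map-≢[] V≢[] ,
  Bounds⇒≻max (Bounds-map f f f-anti (≻min⇒Bounds U≻V))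

≿-map-anti : (k : MultisetOrder μ) → f Preserves _<_ ⟶ _>_ →
             A ≿[ μ ] B → map f B ≿[ dual k ] map f A
≿-map-anti {f = f} ms  f-anti = Sum.map (≻-map-anti ms f-anti) (λ A↭B → map⁺ f (↭-sym A↭B))
≿-map-anti {f = f} dms f-anti = Sum.map (≻-map-anti dms f-anti) (λ A↭B → map⁺ f (↭-sym A↭B))

≿⇒≻-reflected : (k : MultisetOrder μ) → A ≢ [] → B ≢ [] → A ≿[ μ ] B →
                (∀ {x y} → x ≤ y → g y < f x) → map f B ≻[ dual k ] map g A
≿⇒≻-reflected {g = g} {f = f} ms A≢[] _ A≿B reflect =
  Bounds⇒≻dms (map-≢[] A≢[]) (Bounds-map g f reflect (≿ms⇒Bounds A≢[] A≿B))
≿⇒≻-reflected {g = g} {f = f} dms _ B≢[] A≿B reflect =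
  Bounds⇒≻ms (map-≢[] B≢[]) (Bounds-map f g reflect (≿dms⇒Bounds B≢[] A≿B))

shift-≿ : ∀ μ → a ≤ b → A ≢ [] → B ≢ [] → A ≿[ μ ] B → map (_- a) A ≿[ μ ] map (_- b) B
shift-≿ {a = a} μ a≤b A≢[] B≢[] A≿B with ≤⇒<⊎≡ a≤b
... | inj₁ a<b  = ≻⇒≿ μ (≿⇒≻-lowered μ A≢[] B≢[] A≿B (λ x≤y → sub-mono-≤-< x≤y a<b))
... | inj₂ refl = ≿-map-mono μ (λ x<y → sub-mono-<-≤ x<y (ℤ.≤-refl {a})) A≢[] B≢[] A≿B

shift-≻ : ∀ μ → a ≤ b → A ≢ [] → B ≢ [] → A ≿[ μ ] B → A ≻[ μ ] B ⊎ a < b →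
          map (_- a) A ≻[ μ ] map (_- b) B
shift-≻ {a = a} μ a≤b A≢[] B≢[] A≿B strict with ≤⇒<⊎≡ a≤b | strict
... | inj₁ a<b  | _        = ≿⇒≻-lowered μ A≢[] B≢[] A≿B (λ x≤y → sub-mono-≤-< x≤y a<b)
... | inj₂ refl | inj₂ a<a = ⊥-elim (ℤ.<-irrefl refl a<a)
... | inj₂ refl | inj₁ A≻B = ≻-map-mono μ (λ x<y → sub-mono-<-≤ x<y (ℤ.≤-refl {a})) A≻B

reflect-≿ : (k : MultisetOrder μ) → b ≤ a → A ≢ [] → B ≢ [] → A ≿[ μ ] B →
            map (a -_) B ≿[ dual k ] map (b -_) A
reflect-≿ {b = b} k b≤a A≢[] B≢[] A≿B with ≤⇒<⊎≡ b≤a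
... | inj₁ b<a  = ≻⇒≿ (dual k) (≿⇒≻-reflected k A≢[] B≢[] A≿B (λ x≤y → sub-mono-<-≤ b<a x≤y))
... | inj₂ refl = ≿-map-anti k (λ x<y → sub-mono-≤-< (ℤ.≤-refl {b}) x<y) A≿B

reflect-≻ : (k : MultisetOrder μ) → b ≤ a → A ≢ [] → B ≢ [] → A ≿[ μ ] B → b < a ⊎ A ≻[ μ ] B →
            map (a -_) B ≻[ dual k ] map (b -_) A
reflect-≻ {b = b} k b≤a A≢[] B≢[] A≿B strict with ≤⇒<⊎≡ b≤a | strict
... | inj₁ b<a  | _        = ≿⇒≻-reflected k A≢[] B≢[] A≿B (λ x≤y → sub-mono-<-≤ b<a x≤y)
... | inj₂ refl | inj₁ b<b = ⊥-elim (ℤ.<-irrefl refl b<b)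
... | inj₂ refl | inj₂ A≻B = ≻-map-anti k (λ x<y → sub-mono-≤-< (ℤ.≤-refl {b}) x<y) A≻B

data Extremal : MSType → Set where
  max : Extremal max
  min : Extremal min

extremumOf : Extremal μ → List ℤ → Maybe ℤ
extremumOf max = maxOf
extremumOf min = minOf

extremumOf-∷ : (e : Extremal μ) → ∀ x xs → ∃ λ m → extremumOf e (x ∷ xs) ≡ just m
extremumOf-∷ max = maxOf-∷
extremumOf-∷ min = minOf-∷

extremum-≿ : (e : Extremal μ) → extremumOf e A ≡ just a → extremumOf e B ≡ just b →
             A ≿[ μ ] B → b ≤ a
extremum-≿ max ext≡a ext≡b (inj₁ (_ , _ , ext≡a′ , ext≡b′ , b≤a))
  with refl ← trans (sym ext≡a) ext≡a′ | refl ← trans (sym ext≡b) ext≡b′ = b≤a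
extremum-≿ max _ () (inj₂ refl)
extremum-≿ min ext≡a ext≡b (inj₁ (_ , _ , ext≡a′ , ext≡b′ , b≤a))
  with refl ← trans (sym ext≡a) ext≡a′ | refl ← trans (sym ext≡b) ext≡b′ = b≤a
extremum-≿ min () _ (inj₂ refl)

extremum-≻ : (e : Extremal μ) → extremumOf e A ≡ just a → extremumOf e B ≡ just b →
             A ≻[ μ ] B → b < a
extremum-≻ max ext≡a ext≡b (inj₁ (_ , _ , ext≡a′ , ext≡b′ , b<a))
  with refl ← trans (sym ext≡a) ext≡a′ | refl ← trans (sym ext≡b) ext≡b′ = b<a
extremum-≻ max _ () (inj₂ (refl , _))
extremum-≻ min ext≡a ext≡b (inj₁ (_ , _ , ext≡a′ , ext≡b′ , b<a))
  with refl ← trans (sym ext≡a) ext≡a′ | refl ← trans (sym ext≡b) ext≡b′ = b<a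
extremum-≻ min () _ (inj₂ (refl , _))

lowPivot : Extremal μL → ∀ μH → Compatible μL μH
lowPivot max = low-max
lowPivot min = low-min

highPivot : MultisetOrder μL → Extremal μH → Compatible μL μH
highPivot ms  max = ms-max
highPivot ms  min = ms-min
highPivot dms max = dms-max
highPivot dms min = dms-min

diff-lowPivot : (e : Extremal μL) (μH : MSType) → L ≢ [] → H ≢ [] →
                ∃ λ m → extremumOf e L ≡ just m × diff (lowPivot e μH) L H ≡ just (map (_- m) H)
diff-lowPivot {L = []} _ _ L≢[] _ = ⊥-elim (L≢[] refl)
diff-lowPivot {L = _ ∷ _} {H = []} _ _ _ H≢[] = ⊥-elim (H≢[] refl)
diff-lowPivot {L = l ∷ ls} {H = _ ∷ _} e μH _ _ with extremumOf-∷ e l ls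
diff-lowPivot max μH _ _ | m , max≡m rewrite max≡m = m , refl , refl
diff-lowPivot min μH _ _ | m , min≡m rewrite min≡m = m , refl , refl

diff-highPivot : (k : MultisetOrder μL) (e : Extremal μH) → L ≢ [] → H ≢ [] →
                 ∃ λ m → extremumOf e H ≡ just m × diff (highPivot k e) L H ≡ just (map (m -_) L)
diff-highPivot {L = []} _ _ L≢[] _ = ⊥-elim (L≢[] refl)
diff-highPivot {L = _ ∷ _} {H = []} _ _ _ H≢[] = ⊥-elim (H≢[] refl)
diff-highPivot {L = _ ∷ _} {H = h ∷ hs} k e _ _ with extremumOf-∷ e h hs
diff-highPivot ms  max _ _ | m , max≡m rewrite max≡m = m , refl , refl
diff-highPivot ms  min _ _ | m , min≡m rewrite min≡m = m , refl , refl
diff-highPivot dms max _ _ | m , max≡m rewrite max≡m = m , refl , refl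
diff-highPivot dms min _ _ | m , min≡m rewrite min≡m = m , refl , refl

lowPivot-≿ : (e : Extremal μL) (μH : MSType) → Lp ≢ [] → Hp ≢ [] → Lq ≢ [] → Hq ≢ [] →
             Hp ≿[ μH ] Hq → Lq ≿[ μL ] Lp →
             Pointwise (λ A B → A ≿[ μH ] B) (diff (lowPivot e μH) Lp Hp) (diff (lowPivot e μH) Lq Hq)
lowPivot-≿ e μH Lp≢[] Hp≢[] Lq≢[] Hq≢[] H≿ L≿
  with diff-lowPivot e μH Lp≢[] Hp≢[] | diff-lowPivot e μH Lq≢[] Hq≢[]
... | mp , ext≡mp , Φp≡ | mq , ext≡mq , Φq≡ rewrite Φp≡ | Φq≡ =
  just (shift-≿ μH (extremum-≿ e ext≡mq ext≡mp L≿) Hp≢[] Hq≢[] H≿)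

lowPivot-≻ : (e : Extremal μL) (μH : MSType) → Lp ≢ [] → Hp ≢ [] → Lq ≢ [] → Hq ≢ [] →
             Hp ≿[ μH ] Hq → Lq ≿[ μL ] Lp → Hp ≻[ μH ] Hq ⊎ Lq ≻[ μL ] Lp →
             Pointwise (λ A B → A ≻[ μH ] B) (diff (lowPivot e μH) Lp Hp) (diff (lowPivot e μH) Lq Hq)
lowPivot-≻ e μH Lp≢[] Hp≢[] Lq≢[] Hq≢[] H≿ L≿ strict
  with diff-lowPivot e μH Lp≢[] Hp≢[] | diff-lowPivot e μH Lq≢[] Hq≢[]
... | mp , ext≡mp , Φp≡ | mq , ext≡mq , Φq≡ rewrite Φp≡ | Φq≡ =
  just (shift-≻ μH (extremum-≿ e ext≡mq ext≡mp L≿) Hp≢[] Hq≢[] H≿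
                   (Sum.map₂ (extremum-≻ e ext≡mq ext≡mp) strict))

highPivot-≿ : (k : MultisetOrder μL) (e : Extremal μH) → Lp ≢ [] → Hp ≢ [] → Lq ≢ [] → Hq ≢ [] →
              Hp ≿[ μH ] Hq → Lq ≿[ μL ] Lp →
              Pointwise (λ A B → A ≿[ dual k ] B) (diff (highPivot k e) Lp Hp) (diff (highPivot k e) Lq Hq)
highPivot-≿ k e Lp≢[] Hp≢[] Lq≢[] Hq≢[] H≿ L≿
  with diff-highPivot k e Lp≢[] Hp≢[] | diff-highPivot k e Lq≢[] Hq≢[]
... | mp , ext≡mp , Φp≡ | mq , ext≡mq , Φq≡ rewrite Φp≡ | Φq≡ =
  just (reflect-≿ k (extremum-≿ e ext≡mp ext≡mq H≿) Lq≢[] Lp≢[] L≿)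

highPivot-≻ : (k : MultisetOrder μL) (e : Extremal μH) → Lp ≢ [] → Hp ≢ [] → Lq ≢ [] → Hq ≢ [] →
              Hp ≿[ μH ] Hq → Lq ≿[ μL ] Lp → Hp ≻[ μH ] Hq ⊎ Lq ≻[ μL ] Lp →
              Pointwise (λ A B → A ≻[ dual k ] B) (diff (highPivot k e) Lp Hp) (diff (highPivot k e) Lq Hq)
highPivot-≻ k e Lp≢[] Hp≢[] Lq≢[] Hq≢[] H≿ L≿ strict
  with diff-highPivot k e Lp≢[] Hp≢[] | diff-highPivot k e Lq≢[] Hq≢[]
... | mp , ext≡mp , Φp≡ | mq , ext≡mq , Φq≡ rewrite Φp≡ | Φq≡ =
  just (reflect-≻ k (extremum-≿ e ext≡mp ext≡mq H≿) Lq≢[] Lp≢[] L≿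
                    (Sum.map₁ (extremum-≻ e ext≡mp ext≡mq) strict))

diff-≿ : (c : Compatible μL μH) → Lp ≢ [] → Hp ≢ [] → Lq ≢ [] → Hq ≢ [] →
         Hp ≿[ μH ] Hq → Lq ≿[ μL ] Lp →
         Pointwise (λ A B → A ≿[ diffType c ] B) (diff c Lp Hp) (diff c Lq Hq)
diff-≿ (low-max μH) = lowPivot-≿ max μH
diff-≿ (low-min μH) = lowPivot-≿ min μH
diff-≿ ms-max       = highPivot-≿ ms max
diff-≿ ms-min       = highPivot-≿ ms min
diff-≿ dms-max      = highPivot-≿ dms max
diff-≿ dms-min      = highPivot-≿ dms min

diff-≻ : (c : Compatible μL μH) → Lp ≢ [] → Hp ≢ [] → Lq ≢ [] → Hq ≢ [] →
         Hp ≿[ μH ] Hq → Lq ≿[ μL ] Lp → Hp ≻[ μH ] Hq ⊎ Lq ≻[ μL ] Lp →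
         Pointwise (λ A B → A ≻[ diffType c ] B) (diff c Lp Hp) (diff c Lq Hq)
diff-≻ (low-max μH) = lowPivot-≻ max μH
diff-≻ (low-min μH) = lowPivot-≻ min μH
diff-≻ ms-max       = highPivot-≻ ms max
diff-≻ ms-min       = highPivot-≻ ms min
diff-≻ dms-max      = highPivot-≻ dms max
diff-≻ dms-min      = highPivot-≻ dms min

selected-≢[] : ∀ {n} (s : Subset n) {v : Fin n → ℤ} → Nonempty s → selected s v ≢ []
selected-≢[] (true  ∷ s) _ ()
selected-≢[] (false ∷ s) (suc i , there i∈s) = selected-≢[] s (i , i∈s)

corollary4 : (G : MCS) (μL μH : MSType) (f : BiLevelMapping (points G) μL μH)
    (g : Rule (points G)) →
    -- the selections of p and q are non-empty, so that Φ_f is defined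
    Nonempty (low f (src g)) → Nonempty (high f (src g)) →
    Nonempty (low f (tgt g)) → Nonempty (high f (tgt g)) →
    (Orients f g → ∀ σ → Sat g σ →
      Pointwise (λ A B → A ≿[ μD f ] B) (Φ f (src g) (xval g σ)) (Φ f (tgt g) (yval g σ)))
    ×
    (OrientsStrictly f g → ∀ σ → Sat g σ →
      Pointwise (λ A B → A ≻[ μD f ] B) (Φ f (src g) (xval g σ)) (Φ f (tgt g) (yval g σ)))
corollary4 G μL μH f g lp hp lq hq =
  (λ (H≿ , L≿) σ sat → diff-≿ (compat f) Lp≢[] Hp≢[] Lq≢[] Hq≢[] (H≿ σ sat) (L≿ σ sat)) ,
  (λ ((H≿ , L≿) , strict) σ sat →
     diff-≻ (compat f) Lp≢[] Hp≢[] Lq≢[] Hq≢[] (H≿ σ sat) (L≿ σ sat)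
            (Sum.map (λ H≻ → H≻ σ sat) (λ L≻ → L≻ σ sat) strict))
  where
  Lp≢[] : ∀ {v} → selected (low f (src g)) v ≢ []
  Lp≢[] = selected-≢[] (low f (src g)) lp
  Hp≢[] : ∀ {v} → selected (high f (src g)) v ≢ []
  Hp≢[] = selected-≢[] (high f (src g)) hp
  Lq≢[] : ∀ {v} → selected (low f (tgt g)) v ≢ []
  Lq≢[] = selected-≢[] (low f (tgt g)) lq
  Hq≢[] : ∀ {v} → selected (high f (tgt g)) v ≢ []
  Hq≢[] = selected-≢[] (high f (tgt g)) hq
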